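{- Let $s$ and $b$ be positive integers such that $s$ divides $2b$. Define $R_0(b)=s$, $R_1(b)=b$ and $R_{n+1}(b)=\frac{2b}{s}R_n(b)-R_{n-1}(b)$ for $n\geq1$. Then for all non-negative integers $n$ and $m$, \[ C_s\big(R_n(b),R_{n+m}(b),R_m(b)\big)=0, \] where $C_s(x,y,z)=s(x^2+y^2+z^2)-s^3-2xyz$.
   Context: Equivalently $R_n(b)=\frac{s}{2}V_n(2b/s,1)$ with $V_n$ the Lucas sequence of the second kind ($V_0=2$, $V_1=P$, $V_{n+1}=PV_n-QV_{n-1}$). -}

module Defs where

open import Data.Nat as ℕ using (ℕ; zero; suc; NonZero)
open import Data.Nat.DivMod using (_/_)
open import Data.Integer using (ℤ; +_; _+_; _-_; _*_)

-- R_n(b) for parameters s, b with s ≠ 0: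
-- R_0 = s, R_1 = b, R_{n+1} = (2b/s) R_n - R_{n-1}.
-- (2b/s is exact integer division under the theorem's hypothesis s ∣ 2b.)
R : (s b : ℕ) → .{{_ : NonZero s}} → ℕ → ℤ
R s b zero = + s
R s b (suc zero) = + b
R s b (suc (suc n)) = + ((2 ℕ.* b) / s) * R s b (suc n) - R s b n

C : ℕ → ℤ → ℤ → ℤ → ℤ
C s x y z = + s * (x * x + y * y + z * z) - + s * + s * + s - + 2 * x * y * z

{-# OPTIONS --safe #-}
module Submission where

-- For fixed n, both j ↦ R j and j ↦ R (j + n) solve u (j + 2) = k u (j + 1) - u j with
-- k = 2b/s, and C s (R n) y z is a binary quadratic form Q in (z, y) minus a constant K.
-- Along a pair of solutions the triple (Q at step j, Q at step j + 1, polar form of the two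
-- steps) transforms by a linear map fixing (K, K, k K), so Q stays equal to K once these
-- three quantities start there. The initial conditions reduce to k s = 2 b and to the case
-- m = 1, which is the same argument applied to the pair (R, R ∘ suc) with x = b.

open import Defs

-- Integer arithmetic is opened only inside this module, so that the ℕ operators of the
-- theorem can be opened unqualified below it.
module LucasSequences where

  open import Data.Nat as ℕ using (ℕ; zero; suc; NonZero)
  open import Data.Nat.Divisibility using (_∣_)
  open import Data.Nat.DivMod using (_/_; m/n*n≡m)
  open import Data.Integer using (ℤ; +_; -_; 0ℤ; _+_; _-_; _*_)
  open import Data.Integer.Properties using (pos-*; +-identityʳ; i≡j⇒i-j≡0; i-j≡0⇒i≡j)
  open import Data.Integer.Tactic.RingSolver using (solve-∀)
  open import Data.Product using (_×_; _,_; proj₁)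
  open import Relation.Binary.PropositionalEquality
    using (_≡_; refl; sym; trans; cong; cong₂; module ≡-Reasoning)
  open ≡-Reasoning

  Recurrent : ℤ → (ℕ → ℤ) → Set
  Recurrent k u = ∀ j → u (suc (suc j)) ≡ k * u (suc j) - u j

  module BinaryQuadraticForm (p q r : ℤ) where

    Q : ℤ → ℤ → ℤ
    Q a c = p * a * a + q * a * c + r * c * c

    -- Twice the polar form: B a c a′ c′ = Q (a + a′) (c + c′) - Q a c - Q a′ c′.
    B : ℤ → ℤ → ℤ → ℤ → ℤ
    B a c a′ c′ = + 2 * p * a * a′ + q * (a * c′ + a′ * c) + + 2 * r * c * c′

    Q-step : ∀ k a₀ c₀ a₁ c₁ →
      Q (k * a₁ - a₀) (k * c₁ - c₀) ≡ k * k * Q a₁ c₁ - k * B a₀ c₀ a₁ c₁ + Q a₀ c₀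
    Q-step = identity p q r
      where
      identity : ∀ p q r k a₀ c₀ a₁ c₁ →
        p * (k * a₁ - a₀) * (k * a₁ - a₀) + q * (k * a₁ - a₀) * (k * c₁ - c₀)
          + r * (k * c₁ - c₀) * (k * c₁ - c₀)
        ≡ k * k * (p * a₁ * a₁ + q * a₁ * c₁ + r * c₁ * c₁)
          - k * (+ 2 * p * a₀ * a₁ + q * (a₀ * c₁ + a₁ * c₀) + + 2 * r * c₀ * c₁)
          + (p * a₀ * a₀ + q * a₀ * c₀ + r * c₀ * c₀)
      identity = solve-∀

    B-step : ∀ k a₀ c₀ a₁ c₁ →
      B a₁ c₁ (k * a₁ - a₀) (k * c₁ - c₀) ≡ + 2 * k * Q a₁ c₁ - B a₀ c₀ a₁ c₁
    B-step = identity p q r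
      where
      identity : ∀ p q r k a₀ c₀ a₁ c₁ →
        + 2 * p * a₁ * (k * a₁ - a₀) + q * (a₁ * (k * c₁ - c₀) + (k * a₁ - a₀) * c₁)
          + + 2 * r * c₁ * (k * c₁ - c₀)
        ≡ + 2 * k * (p * a₁ * a₁ + q * a₁ * c₁ + r * c₁ * c₁)
          - (+ 2 * p * a₀ * a₁ + q * (a₀ * c₁ + a₁ * c₀) + + 2 * r * c₀ * c₁)
      identity = solve-∀

    Q-next : ∀ {k K a₀ c₀ a₁ c₁} → Q a₀ c₀ ≡ K → Q a₁ c₁ ≡ K → B a₀ c₀ a₁ c₁ ≡ k * K →
      Q (k * a₁ - a₀) (k * c₁ - c₀) ≡ K
    Q-next {k} {K} {a₀} {c₀} {a₁} {c₁} Q₀ Q₁ B₀₁ = begin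
      Q (k * a₁ - a₀) (k * c₁ - c₀)
        ≡⟨ Q-step k a₀ c₀ a₁ c₁ ⟩
      k * k * Q a₁ c₁ - k * B a₀ c₀ a₁ c₁ + Q a₀ c₀
        ≡⟨ cong₂ (λ Q₁′ B₀₁′ → k * k * Q₁′ - k * B₀₁′ + Q a₀ c₀) Q₁ B₀₁ ⟩
      k * k * K - k * (k * K) + Q a₀ c₀
        ≡⟨ cong (λ Q₀′ → k * k * K - k * (k * K) + Q₀′) Q₀ ⟩
      k * k * K - k * (k * K) + K
        ≡⟨ identity k K ⟩
      K ∎
      where
      identity : ∀ k K → k * k * K - k * (k * K) + K ≡ K
      identity = solve-∀

    B-next : ∀ {k K a₀ c₀ a₁ c₁} → Q a₁ c₁ ≡ K → B a₀ c₀ a₁ c₁ ≡ k * K →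
      B a₁ c₁ (k * a₁ - a₀) (k * c₁ - c₀) ≡ k * K
    B-next {k} {K} {a₀} {c₀} {a₁} {c₁} Q₁ B₀₁ = begin
      B a₁ c₁ (k * a₁ - a₀) (k * c₁ - c₀)    ≡⟨ B-step k a₀ c₀ a₁ c₁ ⟩
      + 2 * k * Q a₁ c₁ - B a₀ c₀ a₁ c₁      ≡⟨ cong₂ (λ Q₁′ B₀₁′ → + 2 * k * Q₁′ - B₀₁′) Q₁ B₀₁ ⟩
      + 2 * k * K - k * K                    ≡⟨ identity k K ⟩
      k * K                                  ∎
      where
      identity : ∀ k K → + 2 * k * K - k * K ≡ k * K
      identity = solve-∀

    Q-constant : ∀ {k K a c} → Recurrent k a → Recurrent k c →
      Q (a 0) (c 0) ≡ K → Q (a 1) (c 1) ≡ K → B (a 0) (c 0) (a 1) (c 1) ≡ k * K →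
      ∀ j → Q (a j) (c j) ≡ K
    Q-constant {k} {K} {a} {c} a-rec c-rec Q₀ Q₁ B₀₁ j = proj₁ (invariant j)
      where
      Invariant : ℕ → Set
      Invariant j = Q (a j) (c j) ≡ K × Q (a (suc j)) (c (suc j)) ≡ K
                  × B (a j) (c j) (a (suc j)) (c (suc j)) ≡ k * K

      invariant : ∀ j → Invariant j
      invariant zero = Q₀ , Q₁ , B₀₁
      invariant (suc j) with invariant j
      ... | Qⱼ , Qⱼ₊₁ , Bⱼ =
        Qⱼ₊₁ ,
        trans (cong₂ Q (a-rec j) (c-rec j)) (Q-next {k} Qⱼ Qⱼ₊₁ Bⱼ) ,
        trans (cong₂ (B (a (suc j)) (c (suc j))) (a-rec j) (c-rec j)) (B-next {k} Qⱼ₊₁ Bⱼ)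

  C-swap : ∀ s x y z → C s x y z ≡ C s z y x
  C-swap s = identity (+ s)
    where
    identity : ∀ S x y z →
      S * (x * x + y * y + z * z) - S * S * S - + 2 * x * y * z
      ≡ S * (z * z + y * y + x * x) - S * S * S - + 2 * z * y * x
    identity = solve-∀

  C-diagonal : ∀ s x → C s x x (+ s) ≡ 0ℤ
  C-diagonal s = identity (+ s)
    where
    identity : ∀ S x → S * (x * x + x * x + S * S) - S * S * S - + 2 * x * x * S ≡ 0ℤ
    identity = solve-∀

  module MarkovForm (s : ℕ) (x : ℤ) where

    open BinaryQuadraticForm (+ s) (- (+ 2 * x)) (+ s) public

    K : ℤ
    K = + s * + s * + s - + s * x * x

    C≡Q-K : ∀ y z → C s x y z ≡ Q z y - K
    C≡Q-K = identity (+ s) x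
      where
      identity : ∀ S x y z →
        S * (x * x + y * y + z * z) - S * S * S - + 2 * x * y * z
        ≡ S * z * z + - (+ 2 * x) * z * y + S * y * y - (S * S * S - S * x * x)
      identity = solve-∀

    C-vanishes-along : ∀ {k a c} → Recurrent k a → Recurrent k c →
      C s x (c 0) (a 0) ≡ 0ℤ → C s x (c 1) (a 1) ≡ 0ℤ → B (a 0) (c 0) (a 1) (c 1) ≡ k * K →
      ∀ j → C s x (c j) (a j) ≡ 0ℤ
    C-vanishes-along {k} {a} {c} a-rec c-rec C₀ C₁ B₀₁ j = begin
      C s x (c j) (a j)  ≡⟨ C≡Q-K (c j) (a j) ⟩
      Q (a j) (c j) - K  ≡⟨ i≡j⇒i-j≡0 Q-invariant ⟩
      0ℤ                 ∎
      where
      Q≡K : ∀ {y z} → C s x y z ≡ 0ℤ → Q z y ≡ K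
      Q≡K {y} {z} C≡0 = i-j≡0⇒i≡j _ _ (trans (sym (C≡Q-K y z)) C≡0)

      Q-invariant : Q (a j) (c j) ≡ K
      Q-invariant = Q-constant {k} {K} {a} {c} a-rec c-rec (Q≡K C₀) (Q≡K C₁) B₀₁ j

  module _ (s b : ℕ) .{{_ : NonZero s}} (s∣2b : s ∣ 2 ℕ.* b) where

    k : ℤ
    k = + (2 ℕ.* b / s)

    R-recurrent : Recurrent k (R s b)
    R-recurrent _ = refl

    k*s≡2*b : k * + s ≡ + 2 * + b
    k*s≡2*b = begin
      k * + s                ≡⟨ sym (pos-* (2 ℕ.* b / s) s) ⟩
      + (2 ℕ.* b / s ℕ.* s)  ≡⟨ cong +_ (m/n*n≡m s∣2b) ⟩
      + (2 ℕ.* b)            ≡⟨ pos-* 2 b ⟩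
      + 2 * + b              ∎

    ≡-modulo-k*s≡2*b : ∀ {u v} t → u ≡ v + (k * + s - + 2 * + b) * t → u ≡ v
    ≡-modulo-k*s≡2*b {u} {v} t u≡v+δt = begin
      u                              ≡⟨ u≡v+δt ⟩
      v + (k * + s - + 2 * + b) * t  ≡⟨ cong (λ δ → v + δ * t) (i≡j⇒i-j≡0 k*s≡2*b) ⟩
      v + 0ℤ * t                     ≡⟨ +-identityʳ v ⟩
      v                              ∎

    C-consecutive : ∀ j → C s (+ b) (R s b (suc j)) (R s b j) ≡ 0ℤ
    C-consecutive = C-vanishes-along {k} {R s b} {λ j → R s b (suc j)}
      R-recurrent (λ j → R-recurrent (suc j))
      (C-diagonal s (+ b))
      (≡-modulo-k*s≡2*b (k * + b * + b - + 2 * + s * + b) (C₁-identity (+ s) (+ b) k))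
      (≡-modulo-k*s≡2*b (+ b * + b - + s * + s) (B₀₁-identity (+ s) (+ b) k))
      where
      open MarkovForm s (+ b)
      C₁-identity : ∀ S b k →
        S * (b * b + (k * b - S) * (k * b - S) + b * b) - S * S * S - + 2 * b * (k * b - S) * b
        ≡ 0ℤ + (k * S - + 2 * b) * (k * b * b - + 2 * S * b)
      C₁-identity = solve-∀
      B₀₁-identity : ∀ S b k →
        + 2 * S * S * b + - (+ 2 * b) * (S * (k * b - S) + b * b) + + 2 * S * b * (k * b - S)
        ≡ k * (S * S * S - S * b * b) + (k * S - + 2 * b) * (b * b - S * S)
      B₀₁-identity = solve-∀

    C-vanishes : ∀ n m → C s (R s b n) (R s b (m ℕ.+ n)) (R s b m) ≡ 0ℤ
    C-vanishes n = C-vanishes-along {k} {R s b} {λ j → R s b (j ℕ.+ n)}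
      R-recurrent (λ j → R-recurrent (j ℕ.+ n))
      (C-diagonal s (R s b n))
      (trans (C-swap s (R s b n) (R s b (suc n)) (+ b)) (C-consecutive n))
      (≡-modulo-k*s≡2*b (R s b n * R s b n - + s * + s)
        (B₀₁-identity (+ s) (R s b n) (+ b) (R s b (suc n)) k))
      where
      open MarkovForm s (R s b n)
      B₀₁-identity : ∀ S x b y k →
        + 2 * S * S * b + - (+ 2 * x) * (S * y + b * x) + + 2 * S * x * y
        ≡ k * (S * S * S - S * x * x) + (k * S - + 2 * b) * (x * x - S * S)
      B₀₁-identity = solve-∀

open LucasSequences using (C-vanishes)
open import Data.Nat using (ℕ; _+_; _*_; _<_; NonZero)
open import Data.Nat.Divisibility using (_∣_)
open import Data.Nat.Properties using (+-comm)
open import Data.Integer using (0ℤ)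
open import Relation.Binary.PropositionalEquality using (_≡_)

mainTheorem7 : (s b : ℕ) → .{{_ : NonZero s}} → 0 < b → s ∣ 2 * b →
    (n m : ℕ) → C s (R s b n) (R s b (n + m)) (R s b m) ≡ 0ℤ
mainTheorem7 s b _ s∣2b n m rewrite +-comm n m = C-vanishes s b s∣2b n m
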